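{- Let $f_1,\dots,f_n:\mathbb{R}\to\mathbb{R}$ be monotone nondecreasing functions and $c\in\mathbb{R}$. If a permutation $\sigma:[n]\to[n]$ satisfies that $i\le j$ implies $f_{\sigma(i)}\preceq f_{\sigma(j)}$ for all $i,j\in[n]$, then $\sigma$ is an optimal solution of the maximum total composition ordering problem for $((f_i)_{i\in[n]},c)$, i.e., $\sigma$ maximizes $f_{\sigma(n)}\circ\dots\circ f_{\sigma(1)}(c)$ over all permutations of $[n]$.
   Context: For functions $f,g:\mathbb{R}\to\mathbb{R}$, write $f\preceq g$ if $f\circ g(x)\le g\circ f(x)$ for every $x\in\mathbb{R}$. $[n]=\{1,\dots,n\}$. -}

module Defs where

open import Data.Nat using (ℕ; zero; suc)
open import Data.Fin using (Fin; zero; suc)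
open import Data.Product using (Σ; ∃; _×_)
open import Data.Sum using (_⊎_)
open import Relation.Nullary using (¬_)
open import Relation.Binary.PropositionalEquality using (_≡_)

record RealNumbers : Set₁ where
  infixl 6 _+_
  infixl 7 _*_
  infix 4 _≤_
  field
    ℝ    : Set
    0# 1# : ℝ
    _+_ _*_ : ℝ → ℝ → ℝ
    -_   : ℝ → ℝ
    _≤_  : ℝ → ℝ → Set
    +-assoc   : ∀ x y z → (x + y) + z ≡ x + (y + z)
    +-comm    : ∀ x y → x + y ≡ y + x
    +-identity : ∀ x → 0# + x ≡ x
    +-inverse : ∀ x → (- x) + x ≡ 0#
    *-assoc   : ∀ x y z → (x * y) * z ≡ x * (y * z)
    *-comm    : ∀ x y → x * y ≡ y * x
    *-identity : ∀ x → 1# * x ≡ x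
    distrib   : ∀ x y z → x * (y + z) ≡ x * y + x * z
    0≢1       : ¬ (0# ≡ 1#)
    *-inverse : ∀ x → ¬ (x ≡ 0#) → ∃ λ y → x * y ≡ 1#
    ≤-refl    : ∀ x → x ≤ x
    ≤-trans   : ∀ {x y z} → x ≤ y → y ≤ z → x ≤ z
    ≤-antisym : ∀ {x y} → x ≤ y → y ≤ x → x ≡ y
    ≤-total   : ∀ x y → x ≤ y ⊎ y ≤ x
    +-mono-≤  : ∀ {x y} z → x ≤ y → x + z ≤ y + z
    *-nonneg  : ∀ {x y} → 0# ≤ x → 0# ≤ y → 0# ≤ x * y
    complete  : (P : ℝ → Set) → (∃ λ x → P x) → (∃ λ b → ∀ x → P x → x ≤ b) →
                ∃ λ s → (∀ x → P x → x ≤ s) × (∀ b → (∀ x → P x → x ≤ b) → s ≤ b)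

module _ (R : RealNumbers) where
  open RealNumbers R

  Monotone : (ℝ → ℝ) → Set
  Monotone f = ∀ {x y} → x ≤ y → f x ≤ f y

  _⪯_ : (ℝ → ℝ) → (ℝ → ℝ) → Set
  f ⪯ g = ∀ x → f (g x) ≤ g (f x)

-- composeSeq g c = g (n-1) ∘ ⋯ ∘ g 1 ∘ g 0 (c)  (g 0 is applied first)
composeSeq : ∀ {A : Set} {n : ℕ} → (Fin n → A → A) → A → A
composeSeq {n = zero}  g c = c
composeSeq {n = suc n} g c = composeSeq (λ i → g (suc i)) (g zero c)

module Submission where

-- An exchange argument.  Call f ⊑ g ("f may precede g") when f ∘ g ≤ g ∘ f
-- pointwise.  Take a composition h (n-1) ∘ ⋯ ∘ h 0 of monotone maps and a
-- position p whose map satisfies h p ⊑ h k for every k.  Moving h p to the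
-- front (applying it first) never decreases the value: bubbling it down one
-- place at a time swaps some h k ∘ h p into h p ∘ h k, which by h p ⊑ h k
-- and monotonicity of the remaining outer maps can only increase the result.
--
-- Given a sequence g sorted for ⊑ (i ≤ j implies g i ⊑ g j) and any
-- permutation π, induction on n shows g ∘ π composes to at most g: move the
-- map g 0 (at position π⁻¹ 0) to the front, then apply the induction
-- hypothesis to the remaining n maps, which form the sorted tail g ∘ suc
-- rearranged by the permutation 'remove (π⁻¹ 0) π'.

open import Defs
open import Data.Nat using (ℕ)
open import Data.Fin using (Fin; _≤_)
open import Data.Fin.Permutation using (Permutation′; _⟨$⟩ʳ_)

open import Data.Nat using (zero; suc; z≤n; s≤s)
open import Data.Fin using (zero; suc; punchIn)
open import Data.Fin.Permutation
  using (_⟨$⟩ˡ_; _∘ₚ_; flip; remove; inverseʳ; punchIn-permute′)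
open import Relation.Binary.PropositionalEquality
  using (_≡_; refl; sym; cong; subst; module ≡-Reasoning)

module Exchange {A : Set} (_≼_ : A → A → Set)
                (≼-refl : ∀ x → x ≼ x)
                (≼-trans : ∀ {x y z} → x ≼ y → y ≼ z → x ≼ z) where

  Mono : (A → A) → Set
  Mono h = ∀ {x y} → x ≼ y → h x ≼ h y

  _⊑_ : (A → A) → (A → A) → Set
  f ⊑ g = ∀ x → f (g x) ≼ g (f x)

  ≡⇒≼ : ∀ {x y} → x ≡ y → x ≼ y
  ≡⇒≼ {x} x≡y = subst (x ≼_) x≡y (≼-refl x)

  -- Compositions of pointwise equal sequences agree (no function
  -- extensionality is available, so this is proved by induction).
  composeSeq-cong : ∀ {n} {h h′ : Fin n → A → A} → (∀ i x → h i x ≡ h′ i x) →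
                    ∀ c → composeSeq h c ≡ composeSeq h′ c
  composeSeq-cong {zero}  h≗h′ c = refl
  composeSeq-cong {suc n} {h} {h′} h≗h′ c
    rewrite h≗h′ zero c = composeSeq-cong (λ i → h≗h′ (suc i)) (h′ zero c)

  composeSeq-mono : ∀ {n} (h : Fin n → A → A) → (∀ i → Mono (h i)) →
                    Mono (composeSeq h)
  composeSeq-mono {zero}  h mono x≼y = x≼y
  composeSeq-mono {suc n} h mono x≼y =
    composeSeq-mono (λ i → h (suc i)) (λ i → mono (suc i)) (mono zero x≼y)

  composeSeq-front : ∀ {n} (h : Fin (suc n) → A → A) → (∀ i → Mono (h i)) →
                     (p : Fin (suc n)) → (∀ k → h p ⊑ h k) → ∀ c →
                     composeSeq h c ≼ composeSeq (λ k → h (punchIn p k)) (h p c)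
  composeSeq-front h mono zero first c = ≼-refl _
  composeSeq-front {suc n} h mono (suc p) first c =
    ≼-trans (composeSeq-front (λ i → h (suc i)) (λ i → mono (suc i)) p
                              (λ k → first (suc k)) (h zero c))
            (composeSeq-mono (λ k → h (suc (punchIn p k)))
                             (λ k → mono (suc (punchIn p k))) (first zero c))

  sorted-maximal : ∀ n (g : Fin n → A → A) → (∀ i → Mono (g i)) →
                   (∀ i j → i ≤ j → g i ⊑ g j) → (π : Permutation′ n) → ∀ c →
                   composeSeq (λ i → g (π ⟨$⟩ʳ i)) c ≼ composeSeq g c
  sorted-maximal zero    g mono sorted π c = ≼-refl c
  sorted-maximal (suc n) g mono sorted π c =
    ≼-trans (composeSeq-front (λ i → g (π ⟨$⟩ʳ i)) (λ i → mono (π ⟨$⟩ʳ i)) p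
                              g₀-first c)
    (≼-trans (≡⇒≼ rearranged-tail)
             (sorted-maximal n (λ i → g (suc i)) (λ i → mono (suc i))
                             (λ i j i≤j → sorted (suc i) (suc j) (s≤s i≤j))
                             π′ (g zero c)))
    where
    p : Fin (suc n)
    p = π ⟨$⟩ˡ zero

    π′ : Permutation′ n
    π′ = remove p π

    g₀-first : ∀ k → g (π ⟨$⟩ʳ p) ⊑ g (π ⟨$⟩ʳ k)
    g₀-first k = subst (λ i → g i ⊑ g (π ⟨$⟩ʳ k)) (sym (inverseʳ π))
                       (sorted zero (π ⟨$⟩ʳ k) z≤n)

    rest-is-tail : ∀ k x → g (π ⟨$⟩ʳ punchIn p k) x ≡ g (suc (π′ ⟨$⟩ʳ k)) x
    rest-is-tail k x = cong (λ i → g i x) (punchIn-permute′ π zero k)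

    rearranged-tail : composeSeq (λ k → g (π ⟨$⟩ʳ punchIn p k)) (g (π ⟨$⟩ʳ p) c)
                    ≡ composeSeq (λ k → g (suc (π′ ⟨$⟩ʳ k))) (g zero c)
    rearranged-tail = begin
      composeSeq (λ k → g (π ⟨$⟩ʳ punchIn p k)) (g (π ⟨$⟩ʳ p) c)
        ≡⟨ composeSeq-cong rest-is-tail _ ⟩
      composeSeq (λ k → g (suc (π′ ⟨$⟩ʳ k))) (g (π ⟨$⟩ʳ p) c)
        ≡⟨ cong (λ i → composeSeq (λ k → g (suc (π′ ⟨$⟩ʳ k))) (g i c)) (inverseʳ π) ⟩
      composeSeq (λ k → g (suc (π′ ⟨$⟩ʳ k))) (g zero c)
        ∎
      where open ≡-Reasoning

lemma5 : (R : RealNumbers) → (n : ℕ) → (f : Fin n → RealNumbers.ℝ R → RealNumbers.ℝ R) →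
           (c : RealNumbers.ℝ R) →
           (∀ i → Monotone R (f i)) →
           (σ : Permutation′ n) →
           (∀ i j → i ≤ j → _⪯_ R (f (σ ⟨$⟩ʳ i)) (f (σ ⟨$⟩ʳ j))) →
           (τ : Permutation′ n) →
           RealNumbers._≤_ R (composeSeq (λ i → f (τ ⟨$⟩ʳ i)) c) (composeSeq (λ i → f (σ ⟨$⟩ʳ i)) c)
lemma5 R n f c mono σ sorted τ =
  subst (_≤ℝ composeSeq (λ i → f (σ ⟨$⟩ʳ i)) c)
        (composeSeq-cong same-maps c)
        (sorted-maximal n (λ i → f (σ ⟨$⟩ʳ i)) (λ i → mono (σ ⟨$⟩ʳ i)) sorted π c)
  where
  open RealNumbers R using (ℝ; ≤-refl; ≤-trans) renaming (_≤_ to _≤ℝ_)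
  open Exchange _≤ℝ_ ≤-refl ≤-trans

  -- τ is the sorted order σ rearranged by π = τ ∘ σ⁻¹
  π : Permutation′ n
  π = τ ∘ₚ flip σ

  same-maps : ∀ i (x : ℝ) → f (σ ⟨$⟩ʳ (π ⟨$⟩ʳ i)) x ≡ f (τ ⟨$⟩ʳ i) x
  same-maps i x = cong (λ j → f j x) (inverseʳ σ)
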